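{- Let $n\ge 3$. If $\Gamma=\mathrm{AG}(n,q)$ or $\Gamma=\mathrm{PG}(n,q)$, then the triangle complex $\Delta(\Gamma)$ is not residually connected.
   Context: $\mathrm{AG}(n,q)$ and $\mathrm{PG}(n,q)$ denote the rank two geometries of points and lines of the affine and projective $n$-spaces over $\mathrm{GF}(q)$. Triangle complex: $\Delta(\Gamma)$ is the rank three incidence system over $\{1,2,3\}$ whose elements are the triples $(p,L,i)$ with $p$ incident with $L$ and $i\in\{1,2,3\}$; the type of $(p,L,i)$ is $i$; and $(p,L,i)$ is incident with $(p',L',i \bmod 3+1)$ if and only if the set of points incident with both $L$ and $L'$ is exactly $\{p\}$ and $p\neq p'$ (incidence symmetric and reflexive, no other incidences). The residue of a flag $F$ (set of pairwise incident elements) is the set of elements incident with every element of $F$ but not in $F$, of rank $3-|F|$; a geometry is residually connected if the incidence graph (edges between incident elements of different types) of every residue of rank at least $2$, including the whole geometry, is connected. -}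

module Defs where

open import Level using (Level; _⊔_; 0ℓ) renaming (suc to lsuc)
open import Data.Nat using (ℕ; suc)
open import Data.Fin using (Fin; zero; suc)
open import Data.Product using (Σ; ∃; _×_; _,_)
open import Data.Unit using (⊤)
open import Data.Sum using (_⊎_)
open import Relation.Nullary using (¬_)
open import Relation.Binary.PropositionalEquality using (_≡_)
open import Algebra.Bundles using (CommutativeRing)

record Field c ℓ : Set (lsuc (c ⊔ ℓ)) where
  field
    commutativeRing : CommutativeRing c ℓ
  open CommutativeRing commutativeRing public
  field
    0≉1     : ¬ (0# ≈ 1#)
    inverse : ∀ x → ¬ (x ≈ 0#) → ∃ λ y → (x * y) ≈ 1#

HasSize : ∀ {c ℓ} → Field c ℓ → ℕ → Set (c ⊔ ℓ)
HasSize F q =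
  Σ (Fin q → Carrier) λ f →
    (∀ i j → f i ≈ f j → i ≡ j) × (∀ x → ∃ λ i → f i ≈ x)
  where open Field F

record PointLineGeometry : Set₁ where
  field
    Point : Set
    Line  : Set
    _≈ₚ_  : Point → Point → Set
    _I_   : Point → Line → Set

  _≈ₗ_ : Line → Line → Set
  L ≈ₗ L' = ∀ x → (x I L → x I L') × (x I L' → x I L)

module _ (F : Field 0ℓ 0ℓ) where
  open Field F

  Vector : ℕ → Set
  Vector m = Fin m → Carrier

  _≈ᵥ_ : ∀ {m} → Vector m → Vector m → Set
  u ≈ᵥ v = ∀ i → u i ≈ v i

  NonZero : ∀ {m} → Vector m → Set
  NonZero u = ¬ (∀ i → u i ≈ 0#)

  AG : ℕ → PointLineGeometry
  AG n = record
    { Point = Vector n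
    ; Line  = Σ (Vector n × Vector n) (λ { (a , d) → NonZero d })
    ; _≈ₚ_  = _≈ᵥ_
    ; _I_   = λ { x ((a , d) , _) → ∃ λ t → ∀ i → x i ≈ (a i + t * d i) }
    }

  LinearlyIndependent₂ : ∀ {m} → Vector m → Vector m → Set
  LinearlyIndependent₂ u v =
    ∀ a b → (∀ i → (a * u i + b * v i) ≈ 0#) → (a ≈ 0#) × (b ≈ 0#)

  -- PG(n,F): points are 1-dimensional subspaces of F^(n+1) (nonzero
  -- vectors up to scalar multiples), lines are 2-dimensional subspaces
  -- (spans of two linearly independent vectors); incidence is inclusion.
  PG : ℕ → PointLineGeometry
  PG n = record
    { Point = Σ (Vector (suc n)) NonZero
    ; Line  = Σ (Vector (suc n) × Vector (suc n))
                (λ { (u , v) → LinearlyIndependent₂ u v })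
    ; _≈ₚ_  = λ { (p , _) (p' , _) → ∃ λ λ' → ∀ i → p i ≈ (λ' * p' i) }
    ; _I_   = λ { (p , _) ((u , v) , _) →
                    ∃ λ a → ∃ λ b → ∀ i → p i ≈ (a * u i + b * v i) }
    }

-- types {1,2,3} are represented by Fin 3 (zero ↦ 1, ...);
-- next i corresponds to  i mod 3 + 1.
next : Fin 3 → Fin 3
next zero             = suc zero
next (suc zero)       = suc (suc zero)
next (suc (suc zero)) = zero

module Triangle (Γ : PointLineGeometry) where
  open PointLineGeometry Γ

  record Elem : Set where
    constructor elem
    field
      pt  : Point
      ln  : Line
      inc : pt I ln
      ty  : Fin 3
  open Elem public

  _≈ₑ_ : Elem → Elem → Set
  x ≈ₑ y = (ty x ≡ ty y) × (pt x ≈ₚ pt y) × (ln x ≈ₗ ln y)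

  Adj : Elem → Elem → Set
  Adj x y =
    (ty y ≡ next (ty x)) ×
    (∀ z → ((z I ln x) × (z I ln y) → z ≈ₚ pt x) ×
           (z ≈ₚ pt x → (z I ln x) × (z I ln y))) ×
    ¬ (pt x ≈ₚ pt y)

  Incident : Elem → Elem → Set
  Incident x y = (x ≈ₑ y) ⊎ Adj x y ⊎ Adj y x

  Edge : Elem → Elem → Set
  Edge x y = Incident x y × ¬ (ty x ≡ ty y)

  data Path (S : Elem → Set) : Elem → Elem → Set where
    stop : ∀ {x y} → x ≈ₑ y → Path S x y
    step : ∀ {x y z} → Edge x y → S y → Path S y z → Path S x z

  Connected : (Elem → Set) → Set
  Connected S = ∀ x y → S x → S y → Path S x y

  Residue : Elem → Elem → Set
  Residue x y = Incident x y × ¬ (y ≈ₑ x)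

  -- residues of rank ≥ 2 are those of the empty flag (the whole
  -- geometry) and of the flags {x} of size 1.
  ResiduallyConnected : Set
  ResiduallyConnected = Connected (λ _ → ⊤) × (∀ x → Connected (Residue x))

Δ-ResiduallyConnected : PointLineGeometry → Set
Δ-ResiduallyConnected Γ = Triangle.ResiduallyConnected Γ

{-# OPTIONS --safe #-}
-- Let S be a set of points containing every line through two of its distinct points (below, a
-- coordinate hyperplane x_k = 0) and let x = (p, L, τ) with L ⊆ S.  An edge w — w' of the residue
-- of x satisfies Adj x w, Adj w' x and Adj w w', so p ∈ L ∩ ln w, pt w ∈ ln w ∩ ln w' and
-- pt w' ∈ ln w' ∩ L are pairwise distinct.  If one of ln w, ln w' lies in S, the other contains
-- two distinct points of S and lies in S as well; so "the line lies in S" is constant on the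
-- connected components of the residue of x.  Yet x has neighbours of both kinds: in AG(n, q) take
-- x = (0, ⟨e_i⟩) with neighbours (e_j, ⟨e_j⟩) and (e_k, ⟨e_k⟩); in PG(n, q) take
-- x = (⟨e_i⟩, ⟨e_i, e_j⟩) with neighbours (⟨e_l⟩, ⟨e_l, e_i⟩) and (⟨e_k⟩, ⟨e_k, e_i⟩).  This needs
-- three, resp. four, distinct coordinates, whence n ≥ 3.  Finiteness of the field is used only
-- to decide equality in it.
module Submission where

open import Defs
open import Level using (0ℓ)
open import Data.Nat using (ℕ; _≤_; z≤n; s≤s; suc)
open import Data.Fin using (Fin; zero; suc; #_)
open import Data.Fin.Properties using (inj⇒≟) renaming (_≟_ to _≟ᶠ_)
open import Data.Product using (_×_; _,_; proj₁; proj₂; ∃; swap; map₂)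
open import Data.Sum using (_⊎_; inj₁; inj₂)
open import Data.Empty using (⊥-elim)
open import Function.Bundles using (_⇔_; mk⇔; Equivalence)
open import Relation.Binary.Definitions using (Decidable)
open import Relation.Nullary using (¬_; yes; no)
open import Relation.Nullary.Decidable using (decidable-stable)
import Relation.Binary.PropositionalEquality as ≡
open ≡ using (_≢_)

next-has-no-fixed-point : ∀ τ → τ ≢ next τ
next-has-no-fixed-point zero ()
next-has-no-fixed-point (suc zero) ()
next-has-no-fixed-point (suc (suc zero)) ()

module SubspaceResidues (Γ : PointLineGeometry) where
  open PointLineGeometry Γ
  open Triangle Γ

  _⊆_ : Line → (Point → Set) → Set
  L ⊆ S = ∀ z → z I L → S z

  IsSubspace : (Point → Set) → Set
  IsSubspace S = ∀ a b L → a I L → b I L → ¬ a ≈ₚ b → S a → S b → L ⊆ S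

  adj⇒residue : ∀ {x y} → Adj x y → Residue x y
  adj⇒residue {x} x∼y@(ty≡ , _) =
    inj₂ (inj₁ x∼y) , λ (ty≡′ , _) → next-has-no-fixed-point (ty x) (≡.trans (≡.sym ty≡′) ty≡)

  module _ (≈ₚ-refl : ∀ {p} → p ≈ₚ p) (≈ₚ-sym : ∀ {p p'} → p ≈ₚ p' → p' ≈ₚ p) where

    ≈ₑ-sym : ∀ {x y} → x ≈ₑ y → y ≈ₑ x
    ≈ₑ-sym (ty≡ , pt≈ , ln≈) = ≡.sym ty≡ , ≈ₚ-sym pt≈ , λ z → swap (ln≈ z)

    adj⇒pt-on-ln : ∀ {x y} → Adj x y → pt x I ln y
    adj⇒pt-on-ln {x} (_ , meet , _) = proj₂ (proj₂ (meet (pt x)) ≈ₚ-refl)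

    residue⇒adj : ∀ {x w} → Residue x w → Adj x w ⊎ Adj w x
    residue⇒adj {x} {w} (inj₁ x≈w , w≉x) = ⊥-elim (w≉x (≈ₑ-sym {x} {w} x≈w))
    residue⇒adj (inj₂ x∼w⊎w∼x , _) = x∼w⊎w∼x

    residue-edge-orientation : ∀ {x w w'} → Residue x w → Residue x w' → Adj w w' →
                               Adj x w × Adj w' x
    residue-edge-orientation {x} {w} {w'} r r' w∼w'@(w'≡ , _)
      with residue⇒adj {x} {w} r | residue⇒adj {x} {w'} r'
    ... | inj₁ x∼w      | inj₂ w'∼x     = x∼w , w'∼x
    ... | inj₁ (w≡ , _) | inj₁ (w'≡′ , _) =
      ⊥-elim (next-has-no-fixed-point (ty w) (≡.trans w≡ (≡.trans (≡.sym w'≡′) w'≡)))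
    ... | inj₂ (x≡ , _) | inj₂ (x≡′ , _) =
      ⊥-elim (next-has-no-fixed-point (ty w') (≡.trans w'≡ (≡.trans (≡.sym x≡) x≡′)))
    ... | inj₂ (x≡ , _) | inj₁ (w'≡′ , _) =
      ⊥-elim (next-has-no-fixed-point (ty x) (≡.trans x≡ (≡.trans (≡.sym w'≡) w'≡′)))

    module _ (S : Point → Set) (S-subspace : IsSubspace S) where

      triangle-⊆ : ∀ {x w w'} → Adj x w → Adj w' x → Adj w w' →
                   ln x ⊆ S → ln w ⊆ S ⇔ ln w' ⊆ S
      triangle-⊆ {x} {w} {w'} x∼w@(_ , _ , px≉pw) w'∼x w∼w'@(_ , _ , pw≉pw') lx⊆S = mk⇔
        (λ lw⊆S → S-subspace (pt w) (pt w') (ln w')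
                    (adj⇒pt-on-ln {w} {w'} w∼w') (inc w') pw≉pw'
                    (lw⊆S (pt w) (inc w)) (lx⊆S (pt w') (adj⇒pt-on-ln {w'} {x} w'∼x)))
        (λ lw'⊆S → S-subspace (pt x) (pt w) (ln w)
                     (adj⇒pt-on-ln {x} {w} x∼w) (inc w) px≉pw
                     (lx⊆S (pt x) (inc x)) (lw'⊆S (pt w) (adj⇒pt-on-ln {w} {w'} w∼w')))

      edge-⊆ : ∀ {x y w} → ln x ⊆ S → Residue x y → Residue x w → Edge y w →
               ln y ⊆ S → ln w ⊆ S
      edge-⊆ lx⊆S r r' (inj₁ (ty≡ , _) , ty≢) = ⊥-elim (ty≢ ty≡)
      edge-⊆ {x} {y} {w} lx⊆S r r' (inj₂ (inj₁ y∼w) , _)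
        with residue-edge-orientation {x} {y} {w} r r' y∼w
      ... | x∼y , w∼x = Equivalence.to (triangle-⊆ {x} {y} {w} x∼y w∼x y∼w lx⊆S)
      edge-⊆ {x} {y} {w} lx⊆S r r' (inj₂ (inj₂ w∼y) , _)
        with residue-edge-orientation {x} {w} {y} r' r w∼y
      ... | x∼w , y∼x = Equivalence.from (triangle-⊆ {x} {w} {y} x∼w y∼x w∼y lx⊆S)

      path-⊆ : ∀ {x y z} → ln x ⊆ S → Residue x y → ln y ⊆ S → Path (Residue x) y z →
               ln z ⊆ S
      path-⊆ lx⊆S r ly⊆S (stop (_ , _ , ln≈)) p p∈ = ly⊆S p (proj₂ (ln≈ p) p∈)
      path-⊆ {x} {y} lx⊆S r ly⊆S (step {y = w} e r' path) =
        path-⊆ {x} lx⊆S r' (edge-⊆ {x} {y} {w} lx⊆S r r' e ly⊆S) path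

      ¬residually-connected : ∀ {x y₁ y₂} → ln x ⊆ S → Residue x y₁ → Residue x y₂ →
                              ln y₁ ⊆ S → ¬ (ln y₂ ⊆ S) → ¬ ResiduallyConnected
      ¬residually-connected {x} {y₁} {y₂} lx⊆S r₁ r₂ ly₁⊆S ly₂⊈S (_ , residues-connected) =
        ly₂⊈S (path-⊆ {x} lx⊆S r₁ ly₁⊆S (residues-connected x y₁ y₂ r₁ r₂))

module FieldProperties (F : Field 0ℓ 0ℓ) where
  open Field F hiding (zero)
  open import Relation.Binary.Reasoning.Setoid setoid
  open import Algebra.Solver.Ring.NaturalCoefficients.Default commutativeSemiring
  open import Algebra.Properties.Group +-group using (∙-cancelʳ)

  HasSize⇒≈-dec : ∀ {q} → HasSize F q → Decidable _≈_
  HasSize⇒≈-dec {q} (f , f-injective , f-surjective) = inj⇒≟ {S = setoid} (record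
    { to        = index
    ; cong      = λ {x} {y} x≈y →
                    f-injective _ _ (trans (index-sound x) (trans x≈y (sym (index-sound y))))
    ; injective = λ {x} {y} i≡j →
                    trans (sym (index-sound x)) (trans (reflexive (≡.cong f i≡j)) (index-sound y))
    })
    where
    index : Carrier → Fin q
    index x = proj₁ (f-surjective x)
    index-sound : ∀ x → f (index x) ≈ x
    index-sound x = proj₂ (f-surjective x)

  x≈0⇒x*y≈0 : ∀ {x} y → x ≈ 0# → x * y ≈ 0#
  x≈0⇒x*y≈0 y x≈0 = trans (*-congʳ x≈0) (zeroˡ y)

  y≈0⇒x*y≈0 : ∀ x {y} → y ≈ 0# → x * y ≈ 0#
  y≈0⇒x*y≈0 x y≈0 = trans (*-congˡ y≈0) (zeroʳ x)

  x≈0⇒y≈0⇒x+y≈0 : ∀ {x y} → x ≈ 0# → y ≈ 0# → x + y ≈ 0#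
  x≈0⇒y≈0⇒x+y≈0 x≈0 y≈0 = trans (+-cong x≈0 y≈0) (+-identityʳ 0#)

  *-cancelˡ-≉0 : ∀ {x y z} → ¬ x ≈ 0# → x * y ≈ x * z → y ≈ z
  *-cancelˡ-≉0 {x} {y} {z} x≉0 xy≈xz = begin
    y              ≈⟨ sym (*-identityˡ y) ⟩
    1# * y         ≈⟨ *-congʳ (sym xx⁻¹≈1) ⟩
    x * x⁻¹ * y    ≈⟨ reassoc x x⁻¹ y ⟩
    x⁻¹ * (x * y)  ≈⟨ *-congˡ xy≈xz ⟩
    x⁻¹ * (x * z)  ≈⟨ sym (reassoc x x⁻¹ z) ⟩
    x * x⁻¹ * z    ≈⟨ *-congʳ xx⁻¹≈1 ⟩
    1# * z         ≈⟨ *-identityˡ z ⟩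
    z              ∎
    where
    x⁻¹ : Carrier
    x⁻¹ = proj₁ (inverse x x≉0)
    xx⁻¹≈1 : x * x⁻¹ ≈ 1#
    xx⁻¹≈1 = proj₂ (inverse x x≉0)
    reassoc : ∀ a b c → a * b * c ≈ b * (a * c)
    reassoc = solve 3 (λ a b c → a :* b :* c := b :* (a :* c)) refl

  x≉0⇒x*y≈0⇒y≈0 : ∀ {x y} → ¬ x ≈ 0# → x * y ≈ 0# → y ≈ 0#
  x≉0⇒x*y≈0⇒y≈0 {x} x≉0 xy≈0 = *-cancelˡ-≉0 x≉0 (trans xy≈0 (sym (zeroʳ x)))

  proportional-solutions : ∀ {α β a b a' b'} → ¬ α ≈ 0# →
    a * α + b * β ≈ 0# → a' * α + b' * β ≈ 0# → ¬ (a' ≈ 0# × b' ≈ 0#) →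
    ∃ λ l → a ≈ l * a' × b ≈ l * b'
  proportional-solutions {α} {β} {a} {b} {a'} {b'} α≉0 eq eq' ≉0 = b * μ , a≈ , b≈
    where
    b'≉0 : ¬ b' ≈ 0#
    b'≉0 b'≈0 = ≉0 (x≉0⇒x*y≈0⇒y≈0 α≉0 (begin
      α * a'              ≈⟨ *-comm α a' ⟩
      a' * α              ≈⟨ sym (+-identityʳ _) ⟩
      a' * α + 0#         ≈⟨ +-congˡ (sym (x≈0⇒x*y≈0 β b'≈0)) ⟩
      a' * α + b' * β     ≈⟨ eq' ⟩
      0#                  ∎) , b'≈0)
    μ : Carrier
    μ = proj₁ (inverse b' b'≉0)
    b'μ≈1 : b' * μ ≈ 1#
    b'μ≈1 = proj₂ (inverse b' b'≉0)
    cross : a * b' ≈ a' * b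
    cross = *-cancelˡ-≉0 α≉0 (∙-cancelʳ (b * (b' * β)) _ _ (begin
      α * (a * b') + b * (b' * β)  ≈⟨ solve 5 (λ α β a b b' → α :* (a :* b') :+ b :* (b' :* β)
                                                := b' :* (a :* α :+ b :* β)) refl α β a b b' ⟩
      b' * (a * α + b * β)         ≈⟨ y≈0⇒x*y≈0 b' eq ⟩
      0#                           ≈⟨ sym (y≈0⇒x*y≈0 b eq') ⟩
      b * (a' * α + b' * β)        ≈⟨ solve 5 (λ α β a' b b' → b :* (a' :* α :+ b' :* β)
                                                := α :* (a' :* b) :+ b :* (b' :* β)) refl α β a' b b' ⟩
      α * (a' * b) + b * (b' * β)  ∎))
    a≈ : a ≈ b * μ * a'
    a≈ = begin
      a                ≈⟨ sym (*-identityʳ a) ⟩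
      a * 1#           ≈⟨ *-congˡ (sym b'μ≈1) ⟩
      a * (b' * μ)     ≈⟨ sym (*-assoc a b' μ) ⟩
      a * b' * μ       ≈⟨ *-congʳ cross ⟩
      a' * b * μ       ≈⟨ solve 3 (λ a' b μ → a' :* b :* μ := b :* μ :* a') refl a' b μ ⟩
      b * μ * a'       ∎
    b≈ : b ≈ b * μ * b'
    b≈ = begin
      b                ≈⟨ sym (*-identityʳ b) ⟩
      b * 1#           ≈⟨ *-congˡ (sym b'μ≈1) ⟩
      b * (b' * μ)     ≈⟨ solve 3 (λ b b' μ → b :* (b' :* μ) := b :* μ :* b') refl b b' μ ⟩
      b * μ * b'       ∎

module StandardBasis (F : Field 0ℓ 0ℓ) where
  open Field F hiding (zero)

  basis : ∀ {n} → Fin n → Vector F n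
  basis zero    zero    = 1#
  basis zero    (suc _) = 0#
  basis (suc _) zero    = 0#
  basis (suc i) (suc j) = basis i j

  basis-diag : ∀ {n} (i : Fin n) → basis i i ≈ 1#
  basis-diag zero    = refl
  basis-diag (suc i) = basis-diag i

  basis-off : ∀ {n} {i j : Fin n} → i ≢ j → basis i j ≈ 0#
  basis-off {i = zero}  {zero}  i≢j = ⊥-elim (i≢j ≡.refl)
  basis-off {i = zero}  {suc j} _   = refl
  basis-off {i = suc i} {zero}  _   = refl
  basis-off {i = suc i} {suc j} i≢j = basis-off (λ i≡j → i≢j (≡.cong suc i≡j))

  basis-nonzero : ∀ {n} (i : Fin n) → NonZero F (basis i)
  basis-nonzero i basis≈0 = 0≉1 (trans (sym (basis≈0 i)) (basis-diag i))

module AffineSpace (F : Field 0ℓ 0ℓ) (_≟_ : Decidable (Field._≈_ F)) (n : ℕ) where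
  open Field F hiding (zero)
  open import Relation.Binary.Reasoning.Setoid setoid
  open import Algebra.Properties.Group +-group using (∙-cancelˡ)
  open FieldProperties F
  open StandardBasis F
  open PointLineGeometry (AG F n)
  open Triangle (AG F n)
  open SubspaceResidues (AG F n)

  ≈ₚ-refl : ∀ {u} → u ≈ₚ u
  ≈ₚ-refl _ = refl

  ≈ₚ-sym : ∀ {u v} → u ≈ₚ v → v ≈ₚ u
  ≈ₚ-sym u≈v i = sym (u≈v i)

  Hyperplane : Fin n → Point → Set
  Hyperplane k p = p k ≈ 0#

  hyperplane-isSubspace : ∀ k → IsSubspace (Hyperplane k)
  hyperplane-isSubspace k u v ((a , d) , _) (t , u≈) (s , v≈) u≉v u∈H v∈H z (r , z≈) = begin
    z k            ≈⟨ z≈ k ⟩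
    a k + r * d k  ≈⟨ x≈0⇒y≈0⇒x+y≈0 ak≈0 (y≈0⇒x*y≈0 r dk≈0) ⟩
    0#             ∎
    where
    tdk≈sdk : t * d k ≈ s * d k
    tdk≈sdk = ∙-cancelˡ (a k) _ _ (begin
      a k + t * d k  ≈⟨ sym (u≈ k) ⟩
      u k            ≈⟨ u∈H ⟩
      0#             ≈⟨ sym v∈H ⟩
      v k            ≈⟨ v≈ k ⟩
      a k + s * d k  ∎)
    t≈s : ¬ d k ≈ 0# → t ≈ s
    t≈s dk≉0 = *-cancelˡ-≉0 dk≉0 (trans (*-comm (d k) t) (trans tdk≈sdk (*-comm s (d k))))
    dk≈0 : d k ≈ 0#
    dk≈0 = decidable-stable (d k ≟ 0#) λ dk≉0 → u≉v λ i → begin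
      u i            ≈⟨ u≈ i ⟩
      a i + t * d i  ≈⟨ +-congˡ (*-congʳ (t≈s dk≉0)) ⟩
      a i + s * d i  ≈⟨ sym (v≈ i) ⟩
      v i            ∎
    ak≈0 : a k ≈ 0#
    ak≈0 = begin
      a k            ≈⟨ sym (+-identityʳ (a k)) ⟩
      a k + 0#       ≈⟨ +-congˡ (sym (y≈0⇒x*y≈0 t dk≈0)) ⟩
      a k + t * d k  ≈⟨ sym (u≈ k) ⟩
      u k            ≈⟨ u∈H ⟩
      0#             ∎

  0⃗ : Point
  0⃗ _ = 0#

  axis : Fin n → Line
  axis i = (0⃗ , basis i) , basis-nonzero i

  ≈0⃗⇒on-axis : ∀ {z} i → z ≈ₚ 0⃗ → z I axis i
  ≈0⃗⇒on-axis i z≈0 =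
    0# , λ j → trans (z≈0 j) (sym (trans (+-identityˡ _) (zeroˡ (basis i j))))

  basis-on-axis : ∀ i → basis i I axis i
  basis-on-axis i = 1# , λ j → sym (trans (+-identityˡ _) (*-identityˡ (basis i j)))

  on-axis⇒off-coordinate≈0 : ∀ {z i j} → z I axis i → i ≢ j → z j ≈ 0#
  on-axis⇒off-coordinate≈0 {j = j} (t , z≈) i≢j =
    trans (z≈ j) (trans (+-identityˡ _) (y≈0⇒x*y≈0 t (basis-off i≢j)))

  axis-⊆-hyperplane : ∀ {i k} → i ≢ k → axis i ⊆ Hyperplane k
  axis-⊆-hyperplane i≢k z z∈axis = on-axis⇒off-coordinate≈0 z∈axis i≢k

  axis-⊈-hyperplane : ∀ k → ¬ (axis k ⊆ Hyperplane k)
  axis-⊈-hyperplane k axis⊆H =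
    0≉1 (trans (sym (axis⊆H (basis k) (basis-on-axis k))) (basis-diag k))

  axes-meet-at-origin : ∀ {z i j} → i ≢ j → z I axis i → z I axis j → z ≈ₚ 0⃗
  axes-meet-at-origin {i = i} i≢j z∈i z∈j l with i ≟ᶠ l
  ... | yes ≡.refl = on-axis⇒off-coordinate≈0 z∈j (≡.≢-sym i≢j)
  ... | no i≢l     = on-axis⇒off-coordinate≈0 z∈i i≢l

  origin-elem : Fin n → Fin 3 → Elem
  origin-elem i τ = elem 0⃗ (axis i) (≈0⃗⇒on-axis i ≈ₚ-refl) τ

  basis-elem : Fin n → Fin 3 → Elem
  basis-elem j τ = elem (basis j) (axis j) (basis-on-axis j) τ

  origin∼basis : ∀ {i j} τ → i ≢ j → Adj (origin-elem i τ) (basis-elem j (next τ))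
  origin∼basis {i} {j} τ i≢j =
    ≡.refl ,
    (λ z → (λ (z∈i , z∈j) → axes-meet-at-origin i≢j z∈i z∈j) ,
           (λ z≈0 → ≈0⃗⇒on-axis i z≈0 , ≈0⃗⇒on-axis j z≈0)) ,
    λ 0≈basis → 0≉1 (trans (0≈basis j) (basis-diag j))

  ¬Δ-residually-connected : ∀ i j k → i ≢ j → i ≢ k → j ≢ k →
                            ¬ Δ-ResiduallyConnected (AG F n)
  ¬Δ-residually-connected i j k i≢j i≢k j≢k =
    ¬residually-connected ≈ₚ-refl ≈ₚ-sym (Hyperplane k) (hyperplane-isSubspace k) {x} {y₁} {y₂}
      (axis-⊆-hyperplane i≢k)
      (adj⇒residue {x} {y₁} (origin∼basis zero i≢j))
      (adj⇒residue {x} {y₂} (origin∼basis zero i≢k))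
      (axis-⊆-hyperplane j≢k) (axis-⊈-hyperplane k)
    where
    x y₁ y₂ : Elem
    x  = origin-elem i zero
    y₁ = basis-elem j (suc zero)
    y₂ = basis-elem k (suc zero)

module ProjectiveSpace (F : Field 0ℓ 0ℓ) (_≟_ : Decidable (Field._≈_ F)) (n : ℕ) where
  open Field F hiding (zero)
  open import Relation.Binary.Reasoning.Setoid setoid
  open import Algebra.Solver.Ring.NaturalCoefficients.Default commutativeSemiring
  open FieldProperties F
  open StandardBasis F
  open PointLineGeometry (PG F n)
  open Triangle (PG F n)
  open SubspaceResidues (PG F n)

  ≈ₚ-refl : ∀ {p} → p ≈ₚ p
  ≈ₚ-refl {p , _} = 1# , λ i → sym (*-identityˡ (p i))

  ≈ₚ-sym : ∀ {p p'} → p ≈ₚ p' → p' ≈ₚ p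
  ≈ₚ-sym {p , p≉0} {p' , _} (l , p≈lp') = l⁻¹ , λ i → begin
    p' i              ≈⟨ sym (*-identityˡ (p' i)) ⟩
    1# * p' i         ≈⟨ *-congʳ (sym ll⁻¹≈1) ⟩
    l * l⁻¹ * p' i    ≈⟨ solve 3 (λ l l⁻¹ x → l :* l⁻¹ :* x := l⁻¹ :* (l :* x))
                                 refl l l⁻¹ (p' i) ⟩
    l⁻¹ * (l * p' i)  ≈⟨ *-congˡ (sym (p≈lp' i)) ⟩
    l⁻¹ * p i         ∎
    where
    l≉0 : ¬ l ≈ 0#
    l≉0 l≈0 = p≉0 (λ i → trans (p≈lp' i) (x≈0⇒x*y≈0 (p' i) l≈0))
    l⁻¹ : Carrier
    l⁻¹ = proj₁ (inverse l l≉0)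
    ll⁻¹≈1 : l * l⁻¹ ≈ 1#
    ll⁻¹≈1 = proj₂ (inverse l l≉0)

  Hyperplane : Fin (suc n) → Point → Set
  Hyperplane k (p , _) = p k ≈ 0#

  combination-proportional : ∀ {p p' u v : Vector F (suc n)} {a b a' b' l} →
    (∀ i → p i ≈ a * u i + b * v i) → (∀ i → p' i ≈ a' * u i + b' * v i) →
    a ≈ l * a' → b ≈ l * b' → ∀ i → p i ≈ l * p' i
  combination-proportional {p} {p'} {u} {v} {a} {b} {a'} {b'} {l} p≈ p'≈ a≈la' b≈lb' i = begin
    p i                            ≈⟨ p≈ i ⟩
    a * u i + b * v i              ≈⟨ +-cong (*-congʳ a≈la') (*-congʳ b≈lb') ⟩
    l * a' * u i + l * b' * v i    ≈⟨ solve 5 (λ l a' x b' y → l :* a' :* x :+ l :* b' :* y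
                                                 := l :* (a' :* x :+ b' :* y)) refl l a' (u i) b' (v i) ⟩
    l * (a' * u i + b' * v i)      ≈⟨ *-congˡ (sym (p'≈ i)) ⟩
    l * p' i                       ∎

  hyperplane-∩-span-proportional : ∀ {p p' u v : Vector F (suc n)} {a b a' b'} k →
    (∀ i → p i ≈ a * u i + b * v i) → (∀ i → p' i ≈ a' * u i + b' * v i) → NonZero F p' →
    p k ≈ 0# → p' k ≈ 0# → ¬ u k ≈ 0# → ∃ λ l → ∀ i → p i ≈ l * p' i
  hyperplane-∩-span-proportional {u = u} {v} {a' = a'} {b'} k p≈ p'≈ p'≉0 pk≈0 p'k≈0 uk≉0 =
    map₂ (λ (a≈la' , b≈lb') → combination-proportional p≈ p'≈ a≈la' b≈lb')
         (proportional-solutions uk≉0 (trans (sym (p≈ k)) pk≈0) (trans (sym (p'≈ k)) p'k≈0)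
                                 coefficients≉0)
    where
    coefficients≉0 : ¬ (a' ≈ 0# × b' ≈ 0#)
    coefficients≉0 (a'≈0 , b'≈0) =
      p'≉0 λ i → trans (p'≈ i) (x≈0⇒y≈0⇒x+y≈0 (x≈0⇒x*y≈0 (u i) a'≈0) (x≈0⇒x*y≈0 (v i) b'≈0))

  hyperplane-isSubspace : ∀ k → IsSubspace (Hyperplane k)
  hyperplane-isSubspace k (p , _) (p' , p'≉0) ((u , v) , _) (a , b , p≈) (a' , b' , p'≈)
                        p≉p' p∈H p'∈H (z , _) (c , d , z≈) = begin
    z k                ≈⟨ z≈ k ⟩
    c * u k + d * v k  ≈⟨ x≈0⇒y≈0⇒x+y≈0 (y≈0⇒x*y≈0 c uk≈0) (y≈0⇒x*y≈0 d vk≈0) ⟩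
    0#                 ∎
    where
    uk≈0 : u k ≈ 0#
    uk≈0 = decidable-stable (u k ≟ 0#) λ uk≉0 →
      p≉p' (hyperplane-∩-span-proportional k p≈ p'≈ p'≉0 p∈H p'∈H uk≉0)
    vk≈0 : v k ≈ 0#
    vk≈0 = decidable-stable (v k ≟ 0#) λ vk≉0 →
      p≉p' (hyperplane-∩-span-proportional k (λ i → trans (p≈ i) (+-comm _ _))
              (λ i → trans (p'≈ i) (+-comm _ _)) p'≉0 p∈H p'∈H vk≉0)

  ⟨_⟩ : Fin (suc n) → Point
  ⟨ i ⟩ = basis i , basis-nonzero i

  ⟨⟩-injective : ∀ {i j} → i ≢ j → ¬ ⟨ i ⟩ ≈ₚ ⟨ j ⟩
  ⟨⟩-injective {i} i≢j (l , ei≈lej) =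
    0≉1 (sym (trans (sym (basis-diag i))
                    (trans (ei≈lej i) (y≈0⇒x*y≈0 l (basis-off (≡.≢-sym i≢j))))))

  span-coordinate : ∀ {i j : Fin (suc n)} a b l → i ≢ l → j ≢ l →
                    a * basis i l + b * basis j l ≈ 0#
  span-coordinate a b l i≢l j≢l =
    x≈0⇒y≈0⇒x+y≈0 (y≈0⇒x*y≈0 a (basis-off i≢l)) (y≈0⇒x*y≈0 b (basis-off j≢l))

  basis-independent : ∀ {i j : Fin (suc n)} → i ≢ j →
                      LinearlyIndependent₂ F (basis i) (basis j)
  basis-independent {i} {j} i≢j a b combination≈0 =
    (begin
      a                              ≈⟨ sym (+-identityʳ a) ⟩
      a + 0#                         ≈⟨ +-cong (sym (trans (*-congˡ (basis-diag i)) (*-identityʳ a)))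
                                               (sym (y≈0⇒x*y≈0 b (basis-off (≡.≢-sym i≢j)))) ⟩
      a * basis i i + b * basis j i  ≈⟨ combination≈0 i ⟩
      0#                             ∎) ,
    (begin
      b                              ≈⟨ sym (+-identityˡ b) ⟩
      0# + b                         ≈⟨ +-cong (sym (y≈0⇒x*y≈0 a (basis-off i≢j)))
                                               (sym (trans (*-congˡ (basis-diag j)) (*-identityʳ b))) ⟩
      a * basis i j + b * basis j j  ≈⟨ combination≈0 j ⟩
      0#                             ∎)

  span : (i j : Fin (suc n)) → i ≢ j → Line
  span i j i≢j = (basis i , basis j) , basis-independent i≢j

  ≈⟨⟩⇒on-span-left : ∀ {z i j} (i≢j : i ≢ j) → z ≈ₚ ⟨ i ⟩ → z I span i j i≢j
  ≈⟨⟩⇒on-span-left {j = j} i≢j (l , z≈) =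
    l , 0# , λ m → trans (z≈ m) (sym (trans (+-congˡ (zeroˡ (basis j m))) (+-identityʳ _)))

  ≈⟨⟩⇒on-span-right : ∀ {z i j} (j≢i : j ≢ i) → z ≈ₚ ⟨ i ⟩ → z I span j i j≢i
  ≈⟨⟩⇒on-span-right {j = j} j≢i (l , z≈) =
    0# , l , λ m → trans (z≈ m) (sym (trans (+-congʳ (zeroˡ (basis j m))) (+-identityˡ _)))

  basis-on-span-left : ∀ {i j} (i≢j : i ≢ j) → ⟨ i ⟩ I span i j i≢j
  basis-on-span-left {i} i≢j = ≈⟨⟩⇒on-span-left {⟨ i ⟩} i≢j (≈ₚ-refl {⟨ i ⟩})

  span-⊆-hyperplane : ∀ {i j k} (i≢j : i ≢ j) → i ≢ k → j ≢ k → span i j i≢j ⊆ Hyperplane k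
  span-⊆-hyperplane {k = k} _ i≢k j≢k _ (a , b , z≈) =
    trans (z≈ k) (span-coordinate a b k i≢k j≢k)

  span-⊈-hyperplane : ∀ {i k} (k≢i : k ≢ i) → ¬ (span k i k≢i ⊆ Hyperplane k)
  span-⊈-hyperplane {k = k} k≢i span⊆H =
    0≉1 (trans (sym (span⊆H ⟨ k ⟩ (basis-on-span-left k≢i))) (basis-diag k))

  spans-meet-at-common-basis : ∀ {z i j l} (i≢j : i ≢ j) (l≢i : l ≢ i) → j ≢ l →
    z I span i j i≢j → z I span l i l≢i → z ≈ₚ ⟨ i ⟩
  spans-meet-at-common-basis {z , _} {i} {j} {l} i≢j l≢i j≢l (a , b , z≈) (c , d , z≈') =
    a , coordinate
    where
    coordinate : ∀ m → z m ≈ a * basis i m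
    coordinate m with j ≟ᶠ m
    ... | yes ≡.refl = begin
      z j                            ≈⟨ z≈' j ⟩
      c * basis l j + d * basis i j  ≈⟨ span-coordinate c d j (≡.≢-sym j≢l) i≢j ⟩
      0#                             ≈⟨ sym (y≈0⇒x*y≈0 a (basis-off i≢j)) ⟩
      a * basis i j                  ∎
    ... | no j≢m = begin
      z m                            ≈⟨ z≈ m ⟩
      a * basis i m + b * basis j m  ≈⟨ +-congˡ (y≈0⇒x*y≈0 b (basis-off j≢m)) ⟩
      a * basis i m + 0#             ≈⟨ +-identityʳ _ ⟩
      a * basis i m                  ∎

  pointed-span : (i j : Fin (suc n)) → i ≢ j → Fin 3 → Elem
  pointed-span i j i≢j τ = elem ⟨ i ⟩ (span i j i≢j) (basis-on-span-left i≢j) τ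

  pointed-span∼pointed-span : ∀ {i j l} τ (i≢j : i ≢ j) (l≢i : l ≢ i) → j ≢ l →
    Adj (pointed-span i j i≢j τ) (pointed-span l i l≢i (next τ))
  pointed-span∼pointed-span {i} {j} {l} τ i≢j l≢i j≢l =
    ≡.refl ,
    (λ z → (λ (z∈ij , z∈li) → spans-meet-at-common-basis {z} i≢j l≢i j≢l z∈ij z∈li) ,
           (λ z≈ei → ≈⟨⟩⇒on-span-left {z} i≢j z≈ei , ≈⟨⟩⇒on-span-right {z} l≢i z≈ei)) ,
    ⟨⟩-injective {i} {l} (≡.≢-sym l≢i)

  ¬Δ-residually-connected : ∀ i j k l → i ≢ j → i ≢ k → i ≢ l → j ≢ k → j ≢ l → k ≢ l →
                            ¬ Δ-ResiduallyConnected (PG F n)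
  ¬Δ-residually-connected i j k l i≢j i≢k i≢l j≢k j≢l k≢l =
    ¬residually-connected (λ {p} → ≈ₚ-refl {p}) (λ {p} {p'} → ≈ₚ-sym {p} {p'})
      (Hyperplane k) (hyperplane-isSubspace k) {x} {y₁} {y₂}
      (span-⊆-hyperplane i≢j i≢k j≢k)
      (adj⇒residue {x} {y₁} (pointed-span∼pointed-span zero i≢j l≢i j≢l))
      (adj⇒residue {x} {y₂} (pointed-span∼pointed-span zero i≢j k≢i j≢k))
      (span-⊆-hyperplane l≢i l≢k i≢k) (span-⊈-hyperplane k≢i)
    where
    l≢i : l ≢ i
    l≢i = ≡.≢-sym i≢l
    k≢i : k ≢ i
    k≢i = ≡.≢-sym i≢k
    l≢k : l ≢ k
    l≢k = ≡.≢-sym k≢l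
    x y₁ y₂ : Elem
    x  = pointed-span i j i≢j zero
    y₁ = pointed-span l i l≢i (suc zero)
    y₂ = pointed-span k i k≢i (suc zero)

proposition5p2 : (n q : ℕ) → 3 ≤ n → (F : Field 0ℓ 0ℓ) → HasSize F q →
    ¬ Δ-ResiduallyConnected (AG F n) × ¬ Δ-ResiduallyConnected (PG F n)
proposition5p2 n@(suc (suc (suc _))) q (s≤s (s≤s (s≤s z≤n))) F F-size =
  AffineSpace.¬Δ-residually-connected F _≟_ n (# 0) (# 1) (# 2) (λ ()) (λ ()) (λ ()) ,
  ProjectiveSpace.¬Δ-residually-connected F _≟_ n (# 0) (# 1) (# 2) (# 3)
    (λ ()) (λ ()) (λ ()) (λ ()) (λ ()) (λ ())
  where
  _≟_ : Decidable (Field._≈_ F)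
  _≟_ = FieldProperties.HasSize⇒≈-dec F F-size
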